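{- There is an absolute constant $C$ such that for all $n$ and $W$, $$\mathrm{vfg}(n,W)\le\max\{\mathrm{efg}(n',W) : n'\le Cn\}.$$
   Context: For a directed graph $G=(V,E)$ with nonnegative edge weights $w$, $\mathrm{dist}_w(s,t)$ is the minimum total edge weight of an $s\leadsto t$ path. $\mathrm{efg}(n,W)$ is the least integer such that for every $n$-node directed graph with nonnegative edge costs $\mathrm{cost}$ and nonnegative edge weights $w$ with $w(E)=W$, there is $X\subseteq E$ such that every $s\leadsto t$ path contains an edge of $X$ whenever $\mathrm{dist}_w(s,t)\ge1$, and $\mathrm{cost}(X)\le\langle\mathrm{cost},w\rangle\cdot\mathrm{efg}(n,W)$, where $\mathrm{cost}(X)=\sum_{e\in X}\mathrm{cost}(e)$ and $\langle\mathrm{cost},w\rangle=\sum_e\mathrm{cost}(e)w(e)$. For vertex weights $w$, $\mathrm{vdist}_w(s,t)$ is the minimum over $s\leadsto t$ paths of the total weight of interior vertices (excluding $s,t$). $\mathrm{vfg}(n,W)$ is the least integer such that for every $n$-node directed graph with nonnegative vertex costs and nonnegative vertex weights $w$ with $w(V)=W$, there is $X\subseteq V$ such that every $s\leadsto t$ path contains an internal node in $X$ whenever $\mathrm{vdist}_w(s,t)\ge1$, and $\mathrm{cost}(X)\le\langle\mathrm{cost},w\rangle\cdot\mathrm{vfg}(n,W)$.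
   Formalization: The edge and vertex costs and weights, and the total weight $W$, take values in the rationals. -}

module Defs where

open import Data.Nat using (ℕ; zero; suc)
open import Data.Integer using (+_)
open import Data.Fin using (Fin; zero; suc)
open import Data.Bool using (Bool; true; false; if_then_else_)
open import Data.Rational using (ℚ; 0ℚ; 1ℚ; _+_; _*_; _≤_; _/_)
open import Data.Product using (Σ; _×_)
open import Relation.Binary.PropositionalEquality using (_≡_)

sumFin : ∀ {n} → (Fin n → ℚ) → ℚ
sumFin {zero}  f = 0ℚ
sumFin {suc n} f = f zero + sumFin (λ i → f (suc i))

ℕ→ℚ : ℕ → ℚ
ℕ→ℚ k = + k / 1

Digraph : ℕ → Set
Digraph n = Fin n → Fin n → Bool

data Walk {n} (G : Digraph n) : Fin n → Fin n → Set where
  []  : ∀ {s} → Walk G s s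
  _∷_ : ∀ {s u t} → G s u ≡ true → Walk G u t → Walk G s t

EdgeFun : ℕ → Set
EdgeFun n = Fin n → Fin n → ℚ

sumE : ∀ {n} → Digraph n → EdgeFun n → ℚ
sumE G f = sumFin (λ i → sumFin (λ j → if G i j then f i j else 0ℚ))

walkWeight : ∀ {n} {G : Digraph n} {s t} → EdgeFun n → Walk G s t → ℚ
walkWeight w [] = 0ℚ
walkWeight {s = s} w (_∷_ {u = u} _ p) = w s u + walkWeight w p

data UsesEdge {n} {G : Digraph n} (X : Digraph n) : ∀ {s t} → Walk G s t → Set where
  here  : ∀ {s u t} {e : G s u ≡ true} {p : Walk G u t} → X s u ≡ true → UsesEdge X (e ∷ p)
  there : ∀ {s u t} {e : G s u ≡ true} {p : Walk G u t} → UsesEdge X p → UsesEdge X (e ∷ p)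

DistAtLeast1 : ∀ {n} → Digraph n → EdgeFun n → Fin n → Fin n → Set
DistAtLeast1 G w s t = (p : Walk G s t) → 1ℚ ≤ walkWeight w p

SubE : ∀ {n} → Digraph n → Digraph n → Set
SubE X G = ∀ i j → X i j ≡ true → G i j ≡ true

-- "k is an admissible value in the definition of efg(n,W)":
-- for every n-node digraph with nonneg edge costs and weights, w(E) = W,
-- there is X ⊆ E cutting all pairs at w-distance ≥ 1 with
-- cost(X) ≤ ⟨cost,w⟩ · k.
EfgBound : ℕ → ℚ → ℕ → Set
EfgBound n W k =
  (G : Digraph n) (cost w : EdgeFun n) →
  (∀ i j → 0ℚ ≤ cost i j) → (∀ i j → 0ℚ ≤ w i j) →
  sumE G w ≡ W →
  Σ (Digraph n) λ X → SubE X G ×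
    ((∀ s t → DistAtLeast1 G w s t → (p : Walk G s t) → UsesEdge X p) ×
     (sumE X cost ≤ sumE G (λ i j → cost i j * w i j) * ℕ→ℚ k))

VertexFun : ℕ → Set
VertexFun n = Fin n → ℚ

interiorWeight : ∀ {n} {G : Digraph n} {s t} → VertexFun n → Walk G s t → ℚ
interiorWeight w [] = 0ℚ
interiorWeight w (_ ∷ []) = 0ℚ
interiorWeight w (_∷_ {u = u} _ p@(_ ∷ _)) = w u + interiorWeight w p

data UsesInterior {n} {G : Digraph n} (X : Fin n → Bool) : ∀ {s t} → Walk G s t → Set where
  here  : ∀ {s u v t} {e : G s u ≡ true} {e' : G u v ≡ true} {p : Walk G v t} →
          X u ≡ true → UsesInterior X (e ∷ (e' ∷ p))
  there : ∀ {s u t} {e : G s u ≡ true} {p : Walk G u t} →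
          UsesInterior X p → UsesInterior X (e ∷ p)

VDistAtLeast1 : ∀ {n} → Digraph n → VertexFun n → Fin n → Fin n → Set
VDistAtLeast1 G w s t = (p : Walk G s t) → 1ℚ ≤ interiorWeight w p

sumV : ∀ {n} → (Fin n → Bool) → VertexFun n → ℚ
sumV X f = sumFin (λ i → if X i then f i else 0ℚ)

-- "k is an admissible value in the definition of vfg(n,W)"
VfgBound : ℕ → ℚ → ℕ → Set
VfgBound n W k =
  (G : Digraph n) (cost w : VertexFun n) →
  (∀ i → 0ℚ ≤ cost i) → (∀ i → 0ℚ ≤ w i) →
  sumFin w ≡ W →
  Σ (Fin n → Bool) λ X →
    ((∀ s t → VDistAtLeast1 G w s t → (p : Walk G s t) → UsesInterior X p) ×
     (sumV X cost ≤ sumFin (λ i → cost i * w i) * ℕ→ℚ k))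

-- Split every vertex a into an edge in a → out a carrying the cost and weight of a, and
-- turn every edge a → b into out a → in b, of weight 0 and of cost exceeding the whole
-- budget ⟨cost, w⟩ · k; total weight and ⟨cost, w⟩ are unchanged. Every out s ⇝ in t walk
-- projects to an s ⇝ t walk of no larger interior weight, so vdist_w(s, t) ≥ 1 forces
-- dist(out s, in t) ≥ 1. An edge cut within budget contains no edge out a → in b, so the
-- vertices whose split edge it contains cut every s ⇝ t walk at an interior vertex, at no
-- larger cost. Hence vfg(n, W) ≤ efg(2n, W).
module Submission where

open import Defs
open import Data.Nat using (ℕ; _≤_; _*_)
open import Data.Rational using (ℚ)
open import Data.Product using (Σ)

import Data.Nat as ℕ
import Data.Nat.Properties as ℕ
open import Data.Rational using (0ℚ; 1ℚ; _+_)
import Data.Rational as ℚ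
import Data.Rational.Properties as ℚ
open import Data.Bool using (Bool; true; false; if_then_else_)
open import Data.Empty using (⊥-elim)
open import Data.Fin using (Fin; zero; suc; _↑ˡ_; _↑ʳ_; splitAt; _≟_)
open import Data.Fin.Properties using (splitAt-↑ˡ; splitAt-↑ʳ)
open import Data.Product using (_,_; _×_)
open import Data.Sum using (_⊎_; inj₁; inj₂)
open import Data.Sum.Properties using (inj₁-injective)
open import Function using (_∘_; case_of_)
open import Relation.Nullary using (¬_; does; yes; no)
open import Relation.Nullary.Decidable using (dec-true)
open import Relation.Binary.PropositionalEquality

p≤p+q : ∀ {p q} → 0ℚ ℚ.≤ q → p ℚ.≤ p + q
p≤p+q {p} {q} 0≤q = subst (ℚ._≤ p + q) (ℚ.+-identityʳ p) (ℚ.+-monoʳ-≤ p 0≤q)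

p≤q+p : ∀ {p q} → 0ℚ ℚ.≤ q → p ℚ.≤ q + p
p≤q+p {p} {q} 0≤q = subst (ℚ._≤ q + p) (ℚ.+-identityˡ p) (ℚ.+-monoˡ-≤ p 0≤q)

p+1≰p : ∀ p → ¬ (p + 1ℚ ℚ.≤ p)
p+1≰p p p+1≤p = ℚ.<-irrefl refl (ℚ.<-≤-trans p<p+1 p+1≤p)
  where
  p<p+1 : p ℚ.< p + 1ℚ
  p<p+1 = subst (ℚ._< p + 1ℚ) (ℚ.+-identityʳ p) (ℚ.+-mono-≤-< (ℚ.≤-refl {p}) (ℚ.positive⁻¹ 1ℚ))

*-nonNeg : ∀ {p q} → 0ℚ ℚ.≤ p → 0ℚ ℚ.≤ q → 0ℚ ℚ.≤ p ℚ.* q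
*-nonNeg {p} {q} 0≤p 0≤q = ℚ.nonNegative⁻¹ (p ℚ.* q)
  {{ℚ.nonNeg*nonNeg⇒nonNeg p {{ℚ.nonNegative 0≤p}} q {{ℚ.nonNegative 0≤q}}}}

ℕ→ℚ-nonNeg : ∀ k → 0ℚ ℚ.≤ ℕ→ℚ k
ℕ→ℚ-nonNeg k = ℚ.nonNegative⁻¹ (ℕ→ℚ k) {{ℚ.normalize-nonNeg k 1}}

sumFin-cong : ∀ {n} {f g : Fin n → ℚ} → (∀ i → f i ≡ g i) → sumFin f ≡ sumFin g
sumFin-cong {ℕ.zero}  f≗g = refl
sumFin-cong {ℕ.suc n} f≗g = cong₂ _+_ (f≗g zero) (sumFin-cong (f≗g ∘ suc))

sumFin-zero : ∀ {n} {f : Fin n → ℚ} → (∀ i → f i ≡ 0ℚ) → sumFin f ≡ 0ℚ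
sumFin-zero {ℕ.zero}  f≗0 = refl
sumFin-zero {ℕ.suc n} f≗0 = cong₂ _+_ (f≗0 zero) (sumFin-zero (f≗0 ∘ suc))

sumFin-0 : ∀ n → sumFin {n} (λ _ → 0ℚ) ≡ 0ℚ
sumFin-0 n = sumFin-zero {n} (λ _ → refl)

sumFin-splitAt : ∀ m {k} (g : Fin m ⊎ Fin k → ℚ) →
  sumFin (g ∘ splitAt m) ≡ sumFin (g ∘ inj₁) + sumFin (g ∘ inj₂)
sumFin-splitAt ℕ.zero    g = sym (ℚ.+-identityˡ _)
sumFin-splitAt (ℕ.suc m) g = begin
  g (inj₁ zero) + sumFin (g ∘ Data.Sum.map₁ suc ∘ splitAt m)
    ≡⟨ cong (g (inj₁ zero) +_) (sumFin-splitAt m (g ∘ Data.Sum.map₁ suc)) ⟩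
  g (inj₁ zero) + (sumFin (g ∘ inj₁ ∘ suc) + sumFin (g ∘ inj₂))
    ≡⟨ ℚ.+-assoc (g (inj₁ zero)) _ _ ⟨
  g (inj₁ zero) + sumFin (g ∘ inj₁ ∘ suc) + sumFin (g ∘ inj₂) ∎
  where open ≡-Reasoning

sumFin-if-≟ : ∀ {n} (a : Fin n) (g : Fin n → ℚ) →
  sumFin (λ b → if does (a ≟ b) then g b else 0ℚ) ≡ g a
sumFin-if-≟ {ℕ.suc n} zero g = trans (cong (g zero +_) (sumFin-0 n)) (ℚ.+-identityʳ _)
sumFin-if-≟ (suc a) g = trans (ℚ.+-identityˡ _) (sumFin-if-≟ a (g ∘ suc))

sumFin-mono-≤ : ∀ {n} {f g : Fin n → ℚ} → (∀ i → f i ℚ.≤ g i) → sumFin f ℚ.≤ sumFin g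
sumFin-mono-≤ {ℕ.zero}  f≤g = ℚ.≤-refl
sumFin-mono-≤ {ℕ.suc n} f≤g = ℚ.+-mono-≤ (f≤g zero) (sumFin-mono-≤ (f≤g ∘ suc))

sumFin-nonNeg : ∀ {n} {f : Fin n → ℚ} → (∀ i → 0ℚ ℚ.≤ f i) → 0ℚ ℚ.≤ sumFin f
sumFin-nonNeg {ℕ.zero}  0≤f = ℚ.≤-refl
sumFin-nonNeg {ℕ.suc n} 0≤f = ℚ.+-mono-≤ (0≤f zero) (sumFin-nonNeg (0≤f ∘ suc))

≤-sumFin : ∀ {n} {f : Fin n → ℚ} → (∀ i → 0ℚ ℚ.≤ f i) → ∀ i → f i ℚ.≤ sumFin f
≤-sumFin 0≤f zero    = p≤p+q (sumFin-nonNeg (0≤f ∘ suc))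
≤-sumFin 0≤f (suc i) = ℚ.≤-trans (≤-sumFin (0≤f ∘ suc) i) (p≤q+p (0≤f zero))

sumFin-↑ˡ-≤ : ∀ {m k} {f : Fin (m ℕ.+ k) → ℚ} → (∀ i → 0ℚ ℚ.≤ f i) →
  sumFin (λ i → f (i ↑ˡ k)) ℚ.≤ sumFin f
sumFin-↑ˡ-≤ {ℕ.zero}  0≤f = sumFin-nonNeg 0≤f
sumFin-↑ˡ-≤ {ℕ.suc m} {k} {f} 0≤f = ℚ.+-monoʳ-≤ (f zero) (sumFin-↑ˡ-≤ {m} {k} (0≤f ∘ suc))

edgeTerm : ∀ {n} → Digraph n → EdgeFun n → EdgeFun n
edgeTerm X f i j = if X i j then f i j else 0ℚ

edgeTerm-nonNeg : ∀ {n} (X : Digraph n) {f : EdgeFun n} → (∀ i j → 0ℚ ℚ.≤ f i j) →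
  ∀ i j → 0ℚ ℚ.≤ edgeTerm X f i j
edgeTerm-nonNeg X 0≤f i j with X i j
... | true  = 0≤f i j
... | false = ℚ.≤-refl

≤-sumE : ∀ {n} {X : Digraph n} {f : EdgeFun n} → (∀ i j → 0ℚ ℚ.≤ f i j) →
  ∀ {i j} → X i j ≡ true → f i j ℚ.≤ sumE X f
≤-sumE {X = X} {f} 0≤f {i} {j} ij∈X = ℚ.≤-trans
  (subst (λ b → f i j ℚ.≤ (if b then f i j else 0ℚ)) (sym ij∈X) ℚ.≤-refl)
  (ℚ.≤-trans (≤-sumFin (edgeTerm-nonNeg X 0≤f i) j)
             (≤-sumFin (λ i → sumFin-nonNeg (edgeTerm-nonNeg X 0≤f i)) i))

walkWeight-nonNeg : ∀ {n} {G : Digraph n} {w : EdgeFun n} → (∀ i j → 0ℚ ℚ.≤ w i j) →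
  ∀ {s t} (p : Walk G s t) → 0ℚ ℚ.≤ walkWeight w p
walkWeight-nonNeg 0≤w []      = ℚ.≤-refl
walkWeight-nonNeg 0≤w (e ∷ p) = ℚ.+-mono-≤ (0≤w _ _) (walkWeight-nonNeg 0≤w p)

interiorWeight-∷-≤ : ∀ {n} {G : Digraph n} (w : VertexFun n) {s u t} → 0ℚ ℚ.≤ w u →
  (e : G s u ≡ true) (p : Walk G u t) → interiorWeight w (e ∷ p) ℚ.≤ w u + interiorWeight w p
interiorWeight-∷-≤ w 0≤wu e []      = subst (0ℚ ℚ.≤_) (sym (ℚ.+-identityʳ _)) 0≤wu
interiorWeight-∷-≤ w 0≤wu e (_ ∷ _) = ℚ.≤-refl

-- In Fin n ⊎ Fin n, inj₁ a is the entry copy of a and inj₂ a its exit copy.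
module VertexSplit {n : ℕ} (G : Digraph n) where

  Split : Set
  Split = Fin n ⊎ Fin n

  splitEdge : Split → Split → Bool
  splitEdge (inj₁ a) (inj₂ b) = does (a ≟ b)
  splitEdge (inj₂ a) (inj₁ b) = G a b
  splitEdge _        _        = false

  splitFun : VertexFun n → ℚ → Split → Split → ℚ
  splitFun v c (inj₁ a) (inj₂ b) = v a
  splitFun v c (inj₂ a) (inj₁ b) = c
  splitFun v c _        _        = 0ℚ

  splitFun-nonNeg : ∀ {v c} → (∀ a → 0ℚ ℚ.≤ v a) → 0ℚ ℚ.≤ c → ∀ x y → 0ℚ ℚ.≤ splitFun v c x y
  splitFun-nonNeg 0≤v 0≤c (inj₁ a) (inj₁ b) = ℚ.≤-refl
  splitFun-nonNeg 0≤v 0≤c (inj₁ a) (inj₂ b) = 0≤v a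
  splitFun-nonNeg 0≤v 0≤c (inj₂ a) (inj₁ b) = 0≤c
  splitFun-nonNeg 0≤v 0≤c (inj₂ a) (inj₂ b) = ℚ.≤-refl

  lift : {A : Set} → (Split → Split → A) → Fin (n ℕ.+ n) → Fin (n ℕ.+ n) → A
  lift f x y = f (splitAt n x) (splitAt n y)

  split : Digraph (n ℕ.+ n)
  split = lift splitEdge

  inV outV : Fin n → Fin (n ℕ.+ n)
  inV a  = a ↑ˡ n
  outV a = n ↑ʳ a

  lift-in-out : ∀ {A} (f : Split → Split → A) a b → lift f (inV a) (outV b) ≡ f (inj₁ a) (inj₂ b)
  lift-in-out f a b = cong₂ f (splitAt-↑ˡ n a n) (splitAt-↑ʳ n n b)

  lift-out-in : ∀ {A} (f : Split → Split → A) a b → lift f (outV a) (inV b) ≡ f (inj₂ a) (inj₁ b)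
  lift-out-in f a b = cong₂ f (splitAt-↑ʳ n n a) (splitAt-↑ˡ n b n)

  sumE-split : (f : Split → Split → ℚ) → (∀ a b → f (inj₂ a) (inj₁ b) ≡ 0ℚ) →
    sumE split (lift f) ≡ sumFin (λ a → f (inj₁ a) (inj₂ a))
  sumE-split f f-out-in = begin
    sumFin (row ∘ splitAt n)                    ≡⟨ sumFin-splitAt n row ⟩
    sumFin (row ∘ inj₁) + sumFin (row ∘ inj₂)   ≡⟨ cong₂ _+_ (sumFin-cong in-row) (sumFin-zero out-row) ⟩
    sumFin (λ a → f (inj₁ a) (inj₂ a)) + 0ℚ     ≡⟨ ℚ.+-identityʳ _ ⟩
    sumFin (λ a → f (inj₁ a) (inj₂ a))          ∎
    where
    open ≡-Reasoning
    entry : Split → Split → ℚ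
    entry x y = if splitEdge x y then f x y else 0ℚ

    row : Split → ℚ
    row x = sumFin (entry x ∘ splitAt n)

    in-row : ∀ a → row (inj₁ a) ≡ f (inj₁ a) (inj₂ a)
    in-row a = begin
      row (inj₁ a)                                  ≡⟨ sumFin-splitAt n (entry (inj₁ a)) ⟩
      sumFin {n} (λ _ → 0ℚ) + sumFin (entry (inj₁ a) ∘ inj₂)
        ≡⟨ cong₂ _+_ (sumFin-0 n) (sumFin-if-≟ a (f (inj₁ a) ∘ inj₂)) ⟩
      0ℚ + f (inj₁ a) (inj₂ a)                      ≡⟨ ℚ.+-identityˡ _ ⟩
      f (inj₁ a) (inj₂ a)                           ∎

    out-entry : ∀ a b → entry (inj₂ a) (inj₁ b) ≡ 0ℚ
    out-entry a b with G a b
    ... | true  = f-out-in a b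
    ... | false = refl

    out-row : ∀ a → row (inj₂ a) ≡ 0ℚ
    out-row a = trans (sumFin-splitAt n (entry (inj₂ a)))
      (cong₂ _+_ (sumFin-zero (out-entry a)) (sumFin-0 n))

  split-out-in : ∀ {a b} → G a b ≡ true → split (outV a) (inV b) ≡ true
  split-out-in {a} {b} e = trans (lift-out-in splitEdge a b) e

  split-in-out : ∀ a → split (inV a) (outV a) ≡ true
  split-in-out a = trans (lift-in-out splitEdge a a) (dec-true (a ≟ a) refl)

  splitWalk : ∀ {s u t} → G s u ≡ true → Walk G u t → Walk split (outV s) (inV t)
  splitWalk e []                 = split-out-in e ∷ []
  splitWalk e (_∷_ {s = u} e′ p) = split-out-in e ∷ (split-in-out u ∷ splitWalk e′ p)

  vertexPart : Digraph (n ℕ.+ n) → Fin n → Bool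
  vertexPart X a = X (inV a) (outV a)

  splitWalk-UsesEdge : (X : Digraph (n ℕ.+ n)) → (∀ a b → ¬ X (outV a) (inV b) ≡ true) →
    ∀ {s u t} (e : G s u ≡ true) (p : Walk G u t) →
    UsesEdge X (splitWalk e p) → UsesInterior (vertexPart X) (e ∷ p)
  splitWalk-UsesEdge X no-out-in e []       (here ab∈X)       = ⊥-elim (no-out-in _ _ ab∈X)
  splitWalk-UsesEdge X no-out-in e []       (there ())
  splitWalk-UsesEdge X no-out-in e (e′ ∷ p) (here ab∈X)       = ⊥-elim (no-out-in _ _ ab∈X)
  splitWalk-UsesEdge X no-out-in e (e′ ∷ p) (there (here u∈X)) = here u∈X
  splitWalk-UsesEdge X no-out-in e (e′ ∷ p) (there (there r)) =
    there (splitWalk-UsesEdge X no-out-in e′ p r)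

  sumV-vertexPart-≤ : ∀ X {v c} → (∀ a → 0ℚ ℚ.≤ v a) → 0ℚ ℚ.≤ c →
    sumV (vertexPart X) v ℚ.≤ sumE X (lift (splitFun v c))
  sumV-vertexPart-≤ X {v} {c} 0≤v 0≤c = begin
    sumV (vertexPart X) v
      ≡⟨ sumFin-cong (λ a → cong (if vertexPart X a then_else 0ℚ) (sym (lift-in-out (splitFun v c) a a))) ⟩
    sumFin (λ a → edgeTerm X f (inV a) (outV a))
      ≤⟨ sumFin-mono-≤ (λ a → ≤-sumFin (edgeTerm-nonNeg X 0≤f (inV a)) (outV a)) ⟩
    sumFin (λ a → sumFin (edgeTerm X f (inV a)))
      ≤⟨ sumFin-↑ˡ-≤ {n} {n} (λ i → sumFin-nonNeg (edgeTerm-nonNeg X 0≤f i)) ⟩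
    sumE X f ∎
    where
    open ℚ.≤-Reasoning
    f : EdgeFun (n ℕ.+ n)
    f = lift (splitFun v c)

    0≤f : ∀ x y → 0ℚ ℚ.≤ f x y
    0≤f x y = splitFun-nonNeg 0≤v 0≤c (splitAt n x) (splitAt n y)

  out-edge : ∀ {a} x y → x ≡ inj₂ a → splitEdge x y ≡ true → Σ (Fin n) λ b → y ≡ inj₁ b × G a b ≡ true
  out-edge (inj₂ a) (inj₁ b) refl e = b , refl , e
  out-edge (inj₂ a) (inj₂ b) refl ()

  in-edge : ∀ {a} x y → x ≡ inj₁ a → splitEdge x y ≡ true → y ≡ inj₂ a
  in-edge (inj₁ a) (inj₁ b) refl ()
  in-edge (inj₁ a) (inj₂ b) refl e with a ≟ b
  ... | yes refl = refl
  in-edge (inj₁ a) (inj₂ b) refl () | no _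

  splitFun-out-in : ∀ {v c x y a b} → x ≡ inj₂ a → y ≡ inj₁ b → splitFun v c x y ≡ c
  splitFun-out-in refl refl = refl

  splitFun-in-out : ∀ {v c x y a} → x ≡ inj₁ a → y ≡ inj₂ a → splitFun v c x y ≡ v a
  splitFun-in-out refl refl = refl

  unsplitWalk : ∀ (w : VertexFun n) → (∀ a → 0ℚ ℚ.≤ w a) →
    ∀ {x y s t} → splitAt n x ≡ inj₂ s → splitAt n y ≡ inj₁ t → (q : Walk split x y) →
    Σ (Walk G s t) λ p → interiorWeight w p ℚ.≤ walkWeight (lift (splitFun w 0ℚ)) q
  unsplitWalk w 0≤w x↦s y↦t [] with trans (sym x↦s) y↦t
  ... | ()
  unsplitWalk w 0≤w {x} {y} x↦s y↦t (h ∷ [])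
    with b , y↦b , e ← out-edge (splitAt n x) (splitAt n y) x↦s h
    with refl ← inj₁-injective (trans (sym y↦b) y↦t)
    = e ∷ [] , walkWeight-nonNeg {G = split} 0≤W (h ∷ [])
    where
    0≤W : ∀ x y → 0ℚ ℚ.≤ lift (splitFun w 0ℚ) x y
    0≤W x y = splitFun-nonNeg 0≤w ℚ.≤-refl (splitAt n x) (splitAt n y)
  unsplitWalk w 0≤w {x} x↦s y↦t (_∷_ {u = z} h (_∷_ {u = z′} h′ q))
    with b , z↦b , e ← out-edge (splitAt n x) (splitAt n z) x↦s h
    with z′↦b ← in-edge (splitAt n z) (splitAt n z′) z↦b h′
    with p , p≤q ← unsplitWalk w 0≤w z′↦b y↦t q
    = e ∷ p , (begin
      interiorWeight w (e ∷ p)     ≤⟨ interiorWeight-∷-≤ w (0≤w b) e p ⟩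
      w b + interiorWeight w p     ≤⟨ ℚ.+-monoʳ-≤ (w b) p≤q ⟩
      w b + walkWeight W q         ≡⟨ ℚ.+-identityˡ _ ⟨
      0ℚ + (w b + walkWeight W q)
        ≡⟨ cong₂ (λ α β → α + (β + walkWeight W q)) (splitFun-out-in x↦s z↦b) (splitFun-in-out z↦b z′↦b) ⟨
      walkWeight W (h ∷ (h′ ∷ q))  ∎)
    where
    open ℚ.≤-Reasoning
    W : EdgeFun (n ℕ.+ n)
    W = lift (splitFun w 0ℚ)

module VertexCutFromEdgeCut {n : ℕ} (G : Digraph n) (cost w : VertexFun n)
  (0≤cost : ∀ a → 0ℚ ℚ.≤ cost a) (0≤w : ∀ a → 0ℚ ℚ.≤ w a) (k : ℕ) where

  open VertexSplit G public

  budget : ℚ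
  budget = sumFin (λ a → cost a ℚ.* w a) ℚ.* ℕ→ℚ k

  0≤budget+1 : 0ℚ ℚ.≤ budget + 1ℚ
  0≤budget+1 = ℚ.≤-trans
    (*-nonNeg (sumFin-nonNeg (λ a → *-nonNeg (0≤cost a) (0≤w a))) (ℕ→ℚ-nonNeg k))
    (p≤p+q (ℚ.nonNegative⁻¹ 1ℚ))

  splitCost : EdgeFun (n ℕ.+ n)
  splitCost = lift (splitFun cost (budget + 1ℚ))

  splitWeight : EdgeFun (n ℕ.+ n)
  splitWeight = lift (splitFun w 0ℚ)

  splitCost-nonNeg : ∀ x y → 0ℚ ℚ.≤ splitCost x y
  splitCost-nonNeg x y = splitFun-nonNeg 0≤cost 0≤budget+1 (splitAt n x) (splitAt n y)

  splitWeight-nonNeg : ∀ x y → 0ℚ ℚ.≤ splitWeight x y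
  splitWeight-nonNeg x y = splitFun-nonNeg 0≤w ℚ.≤-refl (splitAt n x) (splitAt n y)

  sumE-splitWeight : sumE split splitWeight ≡ sumFin w
  sumE-splitWeight = sumE-split (splitFun w 0ℚ) (λ _ _ → refl)

  sumE-splitCost*splitWeight :
    sumE split (λ x y → splitCost x y ℚ.* splitWeight x y) ≡ sumFin (λ a → cost a ℚ.* w a)
  sumE-splitCost*splitWeight =
    sumE-split (λ x y → splitFun cost (budget + 1ℚ) x y ℚ.* splitFun w 0ℚ x y) (λ _ _ → ℚ.*-zeroʳ (budget + 1ℚ))

  ≤budget : ∀ {α} → α ℚ.≤ sumE split (λ x y → splitCost x y ℚ.* splitWeight x y) ℚ.* ℕ→ℚ k →
    α ℚ.≤ budget
  ≤budget {α} = subst (λ β → α ℚ.≤ β ℚ.* ℕ→ℚ k) sumE-splitCost*splitWeight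

  module _ (X : Digraph (n ℕ.+ n)) (X-cost : sumE X splitCost ℚ.≤ budget) where

    no-out-in : ∀ a b → ¬ X (outV a) (inV b) ≡ true
    no-out-in a b ab∈X = p+1≰p budget (begin
      budget + 1ℚ              ≡⟨ lift-out-in (splitFun cost (budget + 1ℚ)) a b ⟨
      splitCost (outV a) (inV b) ≤⟨ ≤-sumE splitCost-nonNeg ab∈X ⟩
      sumE X splitCost         ≤⟨ X-cost ⟩
      budget                   ∎)
      where open ℚ.≤-Reasoning

    vertexPart-cuts : (∀ x y → DistAtLeast1 split splitWeight x y → (q : Walk split x y) → UsesEdge X q) →
      ∀ s t → VDistAtLeast1 G w s t → (p : Walk G s t) → UsesInterior (vertexPart X) p
    vertexPart-cuts X-cuts s t far []      = ⊥-elim (p+1≰p 0ℚ (far []))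
    vertexPart-cuts X-cuts s t far (e ∷ p) =
      splitWalk-UsesEdge X no-out-in e p (X-cuts (outV s) (inV t) split-far (splitWalk e p))
      where
      split-far : DistAtLeast1 split splitWeight (outV s) (inV t)
      split-far q with p′ , p′≤q ← unsplitWalk w 0≤w (splitAt-↑ʳ n n s) (splitAt-↑ˡ n t n) q =
        ℚ.≤-trans (far p′) p′≤q

vfgBound-from-efgBound : ∀ n W k → EfgBound (n ℕ.+ n) W k → VfgBound n W k
vfgBound-from-efgBound n W k efg G cost w 0≤cost 0≤w ΣwW =
  case efg split splitCost splitWeight splitCost-nonNeg splitWeight-nonNeg
           (trans sumE-splitWeight ΣwW) of λ where
    (X , _ , X-cuts , X-cost) →
      vertexPart X , vertexPart-cuts X (≤budget X-cost) X-cuts ,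
      ℚ.≤-trans (sumV-vertexPart-≤ X 0≤cost 0≤budget+1) (≤budget X-cost)
  where open VertexCutFromEdgeCut G cost w 0≤cost 0≤w k

theorem9 : Σ ℕ λ C → (n : ℕ) (W : ℚ) (k : ℕ) →
    ((n′ : ℕ) → n′ ≤ C * n → EfgBound n′ W k) → VfgBound n W k
theorem9 = 2 , λ n W k efg →
  vfgBound-from-efgBound n W k (efg (n ℕ.+ n) (ℕ.+-monoʳ-≤ n (ℕ.m≤m+n n 0)))
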